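{- Let $m$ be a positive integer and suppose that $m$ admits a $t$-squared partition. Then there exist positive integers $a,b$ with $m=b^2+2a$ such that $a\equiv b \pmod 2$ and $ta\ge b^2\ge a\ge b$.
   Context: A positive integer $m$ admits a $t$-squared partition if there are positive integers $c_1,\ldots,c_t$ such that $m=b^2+2(c_1^2+\cdots+c_t^2)$ where $b=c_1+\cdots+c_t$. -}

module Defs where

open import Data.Nat using (ℕ; _+_; _*_; _<_)
open import Data.Vec using (Vec; sum; map)
open import Data.Vec.Relation.Unary.All using (All)
open import Data.Product using (Σ; _×_)
open import Relation.Binary.PropositionalEquality using (_≡_)

SquaredPartition : ℕ → ℕ → Set
SquaredPartition t m =
  Σ (Vec ℕ t) λ c →
    All (0 <_) c ×
    m ≡ sum c * sum c + 2 * sum (map (λ x → x * x) c)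

module Submission where

-- Given a t-squared partition m = b² + 2a with positive parts
-- c₁,…,c_t, where b = Σ cᵢ and a = Σ cᵢ², the pair (a, b) itself is the witness:
--   * a ≡ b (mod 2), because cᵢ² ≡ cᵢ (mod 2) for every i;
--   * b ≤ a, because every positive cᵢ satisfies cᵢ ≤ cᵢ²;
--   * a ≤ b², because the square of a sum of naturals dominates the sum of
--     the squares (the cross terms are non-negative);
--   * b² ≤ t·a, which is the Cauchy–Schwarz inequality (Σ cᵢ)² ≤ t·Σ cᵢ²,
--     proved by induction from the AM–GM inequality 2xy ≤ x² + y²;
--   * a, b > 0, since t = 0 would force m = 0.
-- The file first proves these facts for an arbitrary vector of naturals
-- (positivity is assumed only where it is needed) and then assembles them.

open import Defs
open import Data.Nat using (ℕ; zero; suc; _+_; _*_; _<_; _≤_; _%_; z≤n)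
open import Data.Nat.Properties
open import Data.Nat.DivMod using ([m+kn]%n≡m%n)
open import Data.Nat.Solver using (module +-*-Solver)
open import Data.Vec using (Vec; []; _∷_; sum; map)
open import Data.Vec.Relation.Unary.All using (All; []; _∷_)
open import Data.Product using (Σ; _×_; _,_)
open import Data.Sum using (inj₁; inj₂)
open import Relation.Binary.PropositionalEquality using (_≡_; refl; cong; cong₂; trans; module ≡-Reasoning)
open +-*-Solver using (solve; _:+_; _:*_; _:=_; con)

sumSq : ∀ {n} → Vec ℕ n → ℕ
sumSq c = sum (map (λ x → x * x) c)

square≡self+even : ∀ x → Σ ℕ λ k → x * x ≡ x + k * 2
square≡self+even zero = 0 , refl
square≡self+even (suc x) with square≡self+even x
... | k , x²≡x+2k = k + x , (begin
    suc x * suc x        ≡⟨ solve 1 (λ x → (con 1 :+ x) :* (con 1 :+ x) := con 1 :+ x :+ (x :* x :+ x)) refl x ⟩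
    suc x + (x * x + x)  ≡⟨ cong (λ y → suc x + (y + x)) x²≡x+2k ⟩
    suc x + (x + k * 2 + x) ≡⟨ solve 2 (λ x k → con 1 :+ x :+ (x :+ k :* con 2 :+ x) := con 1 :+ x :+ (k :+ x) :* con 2) refl x k ⟩
    suc x + (k + x) * 2  ∎)
  where open ≡-Reasoning

sumSq≡sum+even : ∀ {n} (c : Vec ℕ n) → Σ ℕ λ k → sumSq c ≡ sum c + k * 2
sumSq≡sum+even [] = 0 , refl
sumSq≡sum+even (x ∷ c) with square≡self+even x | sumSq≡sum+even c
... | k , x²≡ | j , c²≡ = k + j , (begin
    x * x + sumSq c               ≡⟨ cong₂ _+_ x²≡ c²≡ ⟩
    x + k * 2 + (sum c + j * 2)   ≡⟨ solve 4 (λ x k s j → x :+ k :* con 2 :+ (s :+ j :* con 2) := x :+ s :+ (k :+ j) :* con 2) refl x k (sum c) j ⟩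
    x + sum c + (k + j) * 2       ∎)
  where open ≡-Reasoning

sumSq≡sum-mod2 : ∀ {n} (c : Vec ℕ n) → sumSq c % 2 ≡ sum c % 2
sumSq≡sum-mod2 c with sumSq≡sum+even c
... | k , c²≡ = trans (cong (_% 2) c²≡) ([m+kn]%n≡m%n (sum c) k 2)

sum≤sumSq : ∀ {n} {c : Vec ℕ n} → All (0 <_) c → sum c ≤ sumSq c
sum≤sumSq [] = z≤n
sum≤sumSq {c = suc x ∷ _} (_ ∷ pos) = +-mono-≤ (m≤m*n (suc x) (suc x)) (sum≤sumSq pos)

sumSq≤sum² : ∀ {n} (c : Vec ℕ n) → sumSq c ≤ sum c * sum c
sumSq≤sum² [] = z≤n
sumSq≤sum² (x ∷ c) = begin
    x * x + sumSq c                   ≤⟨ +-monoʳ-≤ (x * x) (sumSq≤sum² c) ⟩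
    x * x + s * s                     ≤⟨ +-monoʳ-≤ (x * x) (m≤n+m (s * s) (2 * x * s)) ⟩
    x * x + (2 * x * s + s * s)       ≡⟨ solve 2 (λ x s → x :* x :+ (con 2 :* x :* s :+ s :* s) := (x :+ s) :* (x :+ s)) refl x s ⟩
    (x + s) * (x + s)                 ∎
  where
  open ≤-Reasoning
  s = sum c

-- AM–GM: 2xy ≤ x² + y², since (x + d)² + x² = 2x(x + d) + d².
am-gm : ∀ x y → 2 * x * y ≤ x * x + y * y
am-gm x y with ≤-total x y
... | inj₁ x≤y with m≤n⇒∃[o]m+o≡n x≤y
...   | d , refl = begin
    2 * x * (x + d)                  ≤⟨ m≤m+n (2 * x * (x + d)) (d * d) ⟩
    2 * x * (x + d) + d * d          ≡⟨ solve 2 (λ x d → con 2 :* x :* (x :+ d) :+ d :* d := x :* x :+ (x :+ d) :* (x :+ d)) refl x d ⟩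
    x * x + (x + d) * (x + d)        ∎
  where open ≤-Reasoning
am-gm x y | inj₂ y≤x with m≤n⇒∃[o]m+o≡n y≤x
...   | d , refl = begin
    2 * (y + d) * y                  ≤⟨ m≤m+n (2 * (y + d) * y) (d * d) ⟩
    2 * (y + d) * y + d * d          ≡⟨ solve 2 (λ y d → con 2 :* (y :+ d) :* y :+ d :* d := (y :+ d) :* (y :+ d) :+ y :* y) refl y d ⟩
    (y + d) * (y + d) + y * y        ∎
  where open ≤-Reasoning

-- The cross terms of (x + Σ cᵢ)²: summing AM–GM over i gives
-- 2x·Σ cᵢ ≤ n·x² + Σ cᵢ².
cross-terms≤ : ∀ {n} x (c : Vec ℕ n) → 2 * x * sum c ≤ n * (x * x) + sumSq c
cross-terms≤ x [] = ≤-reflexive (*-zeroʳ (2 * x))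
cross-terms≤ {suc n} x (y ∷ c) = begin
    2 * x * (y + sum c)                          ≡⟨ *-distribˡ-+ (2 * x) y (sum c) ⟩
    2 * x * y + 2 * x * sum c                    ≤⟨ +-mono-≤ (am-gm x y) (cross-terms≤ x c) ⟩
    x * x + y * y + (n * (x * x) + sumSq c)      ≡⟨ solve 4 (λ x y n q → x :* x :+ y :* y :+ (n :* (x :* x) :+ q) := (con 1 :+ n) :* (x :* x) :+ (y :* y :+ q)) refl x y n (sumSq c) ⟩
    suc n * (x * x) + (y * y + sumSq c)          ∎
  where open ≤-Reasoning

cauchy-schwarz : ∀ {n} (c : Vec ℕ n) → sum c * sum c ≤ n * sumSq c
cauchy-schwarz [] = z≤n
cauchy-schwarz {suc n} (x ∷ c) = begin
    (x + s) * (x + s)                          ≡⟨ solve 2 (λ x s → (x :+ s) :* (x :+ s) := x :* x :+ con 2 :* x :* s :+ s :* s) refl x s ⟩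
    x * x + 2 * x * s + s * s                  ≤⟨ +-mono-≤ (+-monoʳ-≤ (x * x) (cross-terms≤ x c))
                                                            (cauchy-schwarz c) ⟩
    x * x + (n * (x * x) + sumSq c) + n * sumSq c ≡⟨ solve 3 (λ x n q → x :* x :+ (n :* (x :* x) :+ q) :+ n :* q := (con 1 :+ n) :* (x :* x :+ q)) refl x n (sumSq c) ⟩
    suc n * (x * x + sumSq c)                  ∎
  where
  open ≤-Reasoning
  s = sum c

lemma4p1 : (t m : ℕ) → 0 < m → SquaredPartition t m →
    Σ ℕ λ a → Σ ℕ λ b →
    0 < a × 0 < b × m ≡ b * b + 2 * a × a % 2 ≡ b % 2 ×
    b * b ≤ t * a × a ≤ b * b × b ≤ a
lemma4p1 zero .0 () ([] , [] , refl)
lemma4p1 (suc t) m _ (c@(x ∷ c′) , pos@(x>0 ∷ _) , m≡) =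
  sumSq c , sum c , <-≤-trans b>0 b≤a , b>0 , m≡ , sumSq≡sum-mod2 c ,
  cauchy-schwarz c , sumSq≤sum² c , b≤a
  where
  b>0 : 0 < sum c
  b>0 = <-≤-trans x>0 (m≤m+n x (sum c′))
  b≤a : sum c ≤ sumSq c
  b≤a = sum≤sumSq pos
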